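{- Let $G$ be a finite group, $\mathbb F$ a field, and for $g\in G$ let $P_g$ be the $|G|\times|G|$ permutation matrix over $\mathbb F$ of the action of $g$ on $G$ by left multiplication (the regular representation). Then for any distinct $g_1,g_2\in G$, $\operatorname{rk}(P_{g_1}-P_{g_2})\ge\frac{|G|}2$. -}

module Defs where

open import Level using (Level; _⊔_; suc)
open import Data.Nat using (ℕ; zero)
  renaming (suc to sucℕ)
open import Data.Fin using (Fin; _≟_)
  renaming (zero to fzero; suc to fsuc)
open import Data.Product using (∃; Σ-syntax)
open import Relation.Nullary using (¬_; yes; no)
open import Relation.Binary.PropositionalEquality using (_≡_)
open import Algebra.Bundles using (CommutativeRing; Group)

record Field (c ℓ : Level) : Set (suc (c ⊔ ℓ)) where
  field
    commRing : CommutativeRing c ℓ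
  open CommutativeRing commRing public
  field
    0≉1     : ¬ (0# ≈ 1#)
    inverse : ∀ x → ¬ (x ≈ 0#) → ∃ λ y → x * y ≈ 1#

record FiniteGroup (a ℓ : Level) : Set (suc (a ⊔ ℓ)) where
  field
    group    : Group a ℓ
  open Group group public
  field
    order    : ℕ
    enum     : Fin order → Carrier
    index    : Carrier → Fin order
    index-cong : ∀ {x y} → x ≈ y → index x ≡ index y
    enum-index : ∀ x → enum (index x) ≈ x
    index-enum : ∀ i → index (enum i) ≡ i

module _ {c ℓ : Level} (F : Field c ℓ) where
  open Field F

  -- n × m matrices over F: M r k is the entry in row r, column k.
  Matrix : ℕ → ℕ → Set c
  Matrix n m = Fin n → Fin m → Carrier

  Σ[_]_ : (k : ℕ) → (Fin k → Carrier) → Carrier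
  Σ[ zero ] f = 0#
  Σ[ sucℕ k ] f = f fzero + Σ[ k ] (λ i → f (fsuc i))

  _-ᴹ_ : ∀ {n m} → Matrix n m → Matrix n m → Matrix n m
  (A -ᴹ B) r k = A r k - B r k

  ColumnsIndependent : ∀ {n m k} → Matrix n m → (Fin k → Fin m) → Set (c ⊔ ℓ)
  ColumnsIndependent {k = k} M sel =
    (coef : Fin k → Carrier) →
    (∀ r → Σ[ k ] (λ i → coef i * M r (sel i)) ≈ 0#) →
    ∀ i → coef i ≈ 0#

  RankAtLeast : ∀ {n m} → Matrix n m → ℕ → Set (c ⊔ ℓ)
  RankAtLeast {m = m} M k = Σ[ sel ∈ (Fin k → Fin m) ] ColumnsIndependent M sel

-- The permutation matrix of left multiplication by g on G (regular
-- representation), with G indexed by Fin |G| via enum/index: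
-- column j (the element x_j) has its single 1 in the row of g · x_j.
module _ {a ℓa c ℓ : Level} (G : FiniteGroup a ℓa) (F : Field c ℓ) where
  open FiniteGroup G using (order; enum; index; _∙_) renaming (Carrier to ∣G∣)
  open Field F using (0#; 1#)

  regPerm : ∣G∣ → Matrix F order order
  regPerm g r j with index (g ∙ enum j) ≟ r
  ... | yes _ = 1#
  ... | no _  = 0#

module Submission where

-- Left multiplication by g₁ and by g₂ gives permutations σ₁, σ₂ of G that
-- disagree everywhere, so column x of P_{g₁} − P_{g₂} has exactly two nonzero
-- entries: 1 in row σ₁ x and −1 in row σ₂ x. Among the columns with
-- σ₁ x < σ₂ x, sorting by σ₁ x makes the submatrix triangular with nonzero
-- diagonal, so these columns are independent; symmetrically for the columns
-- with σ₂ x < σ₁ x, sorted by σ₂ x. One of the two classes has at least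
-- |G|/2 elements.

open import Defs
open import Level using (Level)
open import Data.Nat using (ℕ; _≤_; _*_)
open import Data.Product using (Σ-syntax; _×_)
open import Relation.Nullary using (¬_)

open import Data.Nat as ℕ using (zero; suc; _+_; _⊔_)
import Data.Nat.Properties as ℕ
open import Data.Fin using (Fin; _<_; _<?_; _≟_) renaming (zero to fzero; suc to fsuc)
import Data.Fin.Properties as Fin
open import Data.Fin.Induction using (<-wellFounded)
open import Data.Product using (_,_)
open import Data.Sum using (inj₁; inj₂)
open import Function using (_∘_; id)
open import Function.Definitions using (Injective)
open import Induction.WellFounded using (module All)
import Relation.Binary.Construct.On as On
open import Relation.Binary.PropositionalEquality as ≡ using (_≡_; _≢_)
open import Relation.Nullary using (yes; no)
open import Relation.Nullary.Decidable using (¬?)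
open import Relation.Nullary.Negation using (contradiction)
open import Relation.Binary.Definitions using (tri<; tri≈; tri>)
open import Relation.Unary using (Pred; Decidable)
import Algebra.Properties.Group as GroupProperties

module _ {p : Level} where

  count : ∀ {n} {P : Pred (Fin n) p} → Decidable P → ℕ
  count {zero}  P? = 0
  count {suc n} P? with P? fzero
  ... | yes _ = suc (count (P? ∘ fsuc))
  ... | no _  = count (P? ∘ fsuc)

  select : ∀ {n} {P : Pred (Fin n) p} (P? : Decidable P) → Fin (count P?) → Fin n
  select {suc n} P? i with P? fzero
  select {suc n} P? fzero    | yes _ = fzero
  select {suc n} P? (fsuc i) | yes _ = fsuc (select (P? ∘ fsuc) i)
  select {suc n} P? i        | no _  = fsuc (select (P? ∘ fsuc) i)

  select-satisfies : ∀ {n} {P : Pred (Fin n) p} (P? : Decidable P) i → P (select P? i)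
  select-satisfies {suc n} P? i with P? fzero
  select-satisfies {suc n} P? fzero    | yes P0 = P0
  select-satisfies {suc n} P? (fsuc i) | yes _  = select-satisfies (P? ∘ fsuc) i
  select-satisfies {suc n} P? i        | no _   = select-satisfies (P? ∘ fsuc) i

  select-injective : ∀ {n} {P : Pred (Fin n) p} (P? : Decidable P) →
    Injective _≡_ _≡_ (select P?)
  select-injective {suc n} P? {i} {j} eq with P? fzero
  select-injective {suc n} P? {fzero}  {fzero}  eq | yes _ = ≡.refl
  select-injective {suc n} P? {fsuc i} {fsuc j} eq | yes _ =
    ≡.cong fsuc (select-injective (P? ∘ fsuc) (Fin.suc-injective eq))
  select-injective {suc n} P? {i}      {j}      eq | no _ =
    select-injective (P? ∘ fsuc) (Fin.suc-injective eq)

  count-complement : ∀ {n} {P : Pred (Fin n) p} (P? : Decidable P) →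
    count P? + count (¬? ∘ P?) ≡ n
  count-complement {zero}  P? = ≡.refl
  count-complement {suc n} P? with P? fzero
  ... | yes _ = ≡.cong suc (count-complement (P? ∘ fsuc))
  ... | no _  = ≡.trans (ℕ.+-suc _ _) (≡.cong suc (count-complement (P? ∘ fsuc)))

m+n≤2*[m⊔n] : ∀ m n → m + n ≤ 2 * (m ⊔ n)
m+n≤2*[m⊔n] m n = ℕ.≤-trans (ℕ.+-mono-≤ (ℕ.m≤m⊔n m n) (ℕ.m≤n⊔m m n))
                            (ℕ.≤-reflexive (≡.cong (m ⊔ n +_) (≡.sym (ℕ.+-identityʳ (m ⊔ n)))))

module _ {c ℓ : Level} (F : Field c ℓ) where
  open Field F renaming (_*_ to _·_)
  open GroupProperties +-group using (x∙y⁻¹≈ε⇒x≈y)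
  open import Relation.Binary.Reasoning.Setoid setoid

  x·y≈0∧y≉0⇒x≈0 : ∀ x y → x · y ≈ 0# → ¬ (y ≈ 0#) → x ≈ 0#
  x·y≈0∧y≉0⇒x≈0 x y xy≈0 y≉0 with inverse y y≉0
  ... | y⁻¹ , yy⁻¹≈1 = begin
    x              ≈⟨ sym (*-identityʳ x) ⟩
    x · 1#         ≈⟨ *-congˡ (sym yy⁻¹≈1) ⟩
    x · (y · y⁻¹)  ≈⟨ sym (*-assoc x y y⁻¹) ⟩
    (x · y) · y⁻¹  ≈⟨ *-congʳ xy≈0 ⟩
    0# · y⁻¹       ≈⟨ zeroˡ y⁻¹ ⟩
    0#             ∎

  Σ-zero : ∀ k (f : Fin k → Carrier) → (∀ j → f j ≈ 0#) → Σ[_]_ F k f ≈ 0#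
  Σ-zero zero    f f≈0 = refl
  Σ-zero (suc k) f f≈0 =
    trans (+-cong (f≈0 fzero) (Σ-zero k (f ∘ fsuc) (f≈0 ∘ fsuc))) (+-identityˡ 0#)

  Σ-single : ∀ k (f : Fin k → Carrier) i → (∀ j → j ≢ i → f j ≈ 0#) → Σ[_]_ F k f ≈ f i
  Σ-single (suc k) f fzero f≈0 =
    trans (+-congˡ (Σ-zero k (f ∘ fsuc) (λ j → f≈0 (fsuc j) λ ()))) (+-identityʳ _)
  Σ-single (suc k) f (fsuc i) f≈0 =
    trans (+-cong (f≈0 fzero λ ())
                  (Σ-single k (f ∘ fsuc) i (λ j j≢i → f≈0 (fsuc j) (j≢i ∘ Fin.suc-injective))))
          (+-identityˡ _)

  x-y≈0⇒x≈y : ∀ {x y} → x - y ≈ 0# → x ≈ y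
  x-y≈0⇒x≈y = x∙y⁻¹≈ε⇒x≈y _ _

  lowerTriangular⇒independent : ∀ {n m k} (M : Matrix F n m) (sel : Fin k → Fin m)
    (row : Fin k → Fin n) →
    Injective _≡_ _≡_ row →
    (∀ i → ¬ (M (row i) (sel i) ≈ 0#)) →
    (∀ i j → row i < row j → M (row i) (sel j) ≈ 0#) →
    ColumnsIndependent F M sel
  lowerTriangular⇒independent {k = k} M sel row row-inj pivot upper≈0 coef combination≈0 =
    All.wfRec (On.wellFounded row <-wellFounded) _ (λ i → coef i ≈ 0#) coef≈0
    where
    coef≈0 : ∀ i → (∀ {j} → row j < row i → coef j ≈ 0#) → coef i ≈ 0#
    coef≈0 i earlier≈0 =
      x·y≈0∧y≉0⇒x≈0 _ _ (trans (sym (Σ-single k _ i other≈0)) (combination≈0 (row i))) (pivot i)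
      where
      other≈0 : ∀ j → j ≢ i → coef j · M (row i) (sel j) ≈ 0#
      other≈0 j j≢i with Fin.<-cmp (row i) (row j)
      ... | tri< i<j _ _ = trans (*-congˡ (upper≈0 i j i<j)) (zeroʳ _)
      ... | tri≈ _ i≡j _ = contradiction (row-inj (≡.sym i≡j)) j≢i
      ... | tri> _ _ j<i = trans (*-congʳ (earlier≈0 j<i)) (zeroˡ _)

  twoEntryColumns⇒independent : ∀ {n m k} (M : Matrix F n m) (sel : Fin k → Fin m)
    (top bot : Fin k → Fin n) →
    Injective _≡_ _≡_ top →
    (∀ i → top i < bot i) →
    (∀ i → ¬ (M (top i) (sel i) ≈ 0#)) →
    (∀ r i → r ≢ top i → r ≢ bot i → M r (sel i) ≈ 0#) →
    ColumnsIndependent F M sel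
  twoEntryColumns⇒independent M sel top bot top-inj top<bot pivot support =
    lowerTriangular⇒independent M sel top top-inj pivot upper≈0
    where
    upper≈0 : ∀ i j → top i < top j → M (top i) (sel j) ≈ 0#
    upper≈0 i j i<j = support (top i) j (Fin.<⇒≢ i<j) (Fin.<⇒≢ (Fin.<-trans i<j (top<bot j)))

  twoEntryColumns⇒rankAtLeast : ∀ {n m q} (M : Matrix F n m) (top bot : Fin m → Fin n) →
    Injective _≡_ _≡_ top →
    (∀ j → ¬ (M (top j) j ≈ 0#)) →
    (∀ r j → r ≢ top j → r ≢ bot j → M r j ≈ 0#) →
    {P : Pred (Fin m) q} (P? : Decidable P) → (∀ {j} → P j → top j < bot j) →
    RankAtLeast F M (count P?)
  twoEntryColumns⇒rankAtLeast M top bot top-inj pivot support P? top<bot =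
    select P? , twoEntryColumns⇒independent M (select P?) (top ∘ select P?) (bot ∘ select P?)
                  (select-injective P? ∘ top-inj) (top<bot ∘ select-satisfies P?)
                  (pivot ∘ select P?) (λ r → support r ∘ select P?)

module _ {a ℓa : Level} (G : FiniteGroup a ℓa) where
  open FiniteGroup G using (order; enum; index; index-cong; enum-index; index-enum; _∙_)
    renaming (Carrier to ∣G∣; _≈_ to _≈ᴳ_)
  module G = FiniteGroup G
  open GroupProperties G.group using (∙-cancelˡ; ∙-cancelʳ)

  translate : ∣G∣ → Fin order → Fin order
  translate g j = index (g ∙ enum j)

  index-injective : ∀ {x y} → index x ≡ index y → x ≈ᴳ y
  index-injective {x} {y} eq =
    G.trans (G.sym (enum-index x)) (G.trans (G.reflexive (≡.cong enum eq)) (enum-index y))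

  enum-injective : ∀ {i j} → enum i ≈ᴳ enum j → i ≡ j
  enum-injective {i} {j} eq = ≡.trans (≡.sym (index-enum i)) (≡.trans (index-cong eq) (index-enum j))

  translate-injective : ∀ g → Injective _≡_ _≡_ (translate g)
  translate-injective g eq = enum-injective (∙-cancelˡ g _ _ (index-injective eq))

  translate-apart : ∀ {g h} → ¬ (g ≈ᴳ h) → ∀ j → translate g j ≢ translate h j
  translate-apart g≉h j eq = g≉h (∙-cancelʳ (enum j) _ _ (index-injective eq))

module _ {a ℓa c ℓ : Level} (G : FiniteGroup a ℓa) (F : Field c ℓ) where
  open FiniteGroup G using (order) renaming (Carrier to ∣G∣)
  open Field F using (_≈_; 0#; 1#; 0≉1)
  module F = Field F

  regPerm-hit : ∀ g r j → translate G g j ≡ r → regPerm G F g r j ≡ 1#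
  regPerm-hit g r j gj≡r with translate G g j ≟ r
  ... | yes _    = ≡.refl
  ... | no gj≢r = contradiction gj≡r gj≢r

  regPerm-miss : ∀ g r j → translate G g j ≢ r → regPerm G F g r j ≡ 0#
  regPerm-miss g r j gj≢r with translate G g j ≟ r
  ... | yes gj≡r = contradiction gj≡r gj≢r
  ... | no _     = ≡.refl

  module _ (g h : ∣G∣) where
    private
      M : Matrix F order order
      M = _-ᴹ_ F (regPerm G F g) (regPerm G F h)

    regPerm-difference : ∀ {r j x y} → regPerm G F g r j ≡ x → regPerm G F h r j ≡ y →
      M r j ≈ x F.- y
    regPerm-difference gx hy = F.+-cong (F.reflexive gx) (F.-‿cong (F.reflexive hy))

    regPerm-difference-off : ∀ r j → r ≢ translate G g j → r ≢ translate G h j → M r j ≈ 0#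
    regPerm-difference-off r j r≢gj r≢hj =
      F.trans (regPerm-difference (regPerm-miss g r j (r≢gj ∘ ≡.sym))
                                  (regPerm-miss h r j (r≢hj ∘ ≡.sym)))
              (F.-‿inverseʳ 0#)

    regPerm-difference-pivotˡ : ∀ j → translate G g j ≢ translate G h j →
      ¬ (M (translate G g j) j ≈ 0#)
    regPerm-difference-pivotˡ j gj≢hj M≈0 = 0≉1 (F.sym (x-y≈0⇒x≈y F (F.trans (F.sym 1-0) M≈0)))
      where
      1-0 : M (translate G g j) j ≈ 1# F.- 0#
      1-0 = regPerm-difference (regPerm-hit g _ j ≡.refl) (regPerm-miss h _ j (gj≢hj ∘ ≡.sym))

    regPerm-difference-pivotʳ : ∀ j → translate G g j ≢ translate G h j →
      ¬ (M (translate G h j) j ≈ 0#)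
    regPerm-difference-pivotʳ j gj≢hj M≈0 = 0≉1 (x-y≈0⇒x≈y F (F.trans (F.sym 0-1) M≈0))
      where
      0-1 : M (translate G h j) j ≈ 0# F.- 1#
      0-1 = regPerm-difference (regPerm-miss g _ j gj≢hj) (regPerm-hit h _ j ≡.refl)

⊔-preserves : ∀ {p} (P : Pred ℕ p) {m n} → P m → P n → P (m ⊔ n)
⊔-preserves P {m} {n} pm pn with ℕ.⊔-sel m n
... | inj₁ m⊔n≡m = ≡.subst P (≡.sym m⊔n≡m) pm
... | inj₂ m⊔n≡n = ≡.subst P (≡.sym m⊔n≡n) pn

corollary3p8 : {a ℓa c ℓ : Level} (G : FiniteGroup a ℓa) (F : Field c ℓ)
    (g₁ g₂ : FiniteGroup.Carrier G) → ¬ (FiniteGroup._≈_ G g₁ g₂) →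
    Σ[ k ∈ ℕ ] ((FiniteGroup.order G ≤ 2 * k) × RankAtLeast F (_-ᴹ_ F (regPerm G F g₁) (regPerm G F g₂)) k)
corollary3p8 G F g₁ g₂ g₁≉g₂ =
  k₁ ⊔ k₂ ,
  ≡.subst (_≤ 2 * (k₁ ⊔ k₂)) (count-complement P?) (m+n≤2*[m⊔n] k₁ k₂) ,
  ⊔-preserves (RankAtLeast F M) rank₁ rank₂
  where
  n : ℕ
  n = FiniteGroup.order G

  M : Matrix F n n
  M = _-ᴹ_ F (regPerm G F g₁) (regPerm G F g₂)

  σ₁ σ₂ : Fin n → Fin n
  σ₁ = translate G g₁
  σ₂ = translate G g₂

  σ₁≢σ₂ : ∀ j → σ₁ j ≢ σ₂ j
  σ₁≢σ₂ = translate-apart G g₁≉g₂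

  P? : Decidable (λ j → σ₁ j < σ₂ j)
  P? j = σ₁ j <? σ₂ j

  k₁ k₂ : ℕ
  k₁ = count P?
  k₂ = count (¬? ∘ P?)

  rank₁ : RankAtLeast F M k₁
  rank₁ = twoEntryColumns⇒rankAtLeast F M σ₁ σ₂ (translate-injective G g₁)
            (λ j → regPerm-difference-pivotˡ G F g₁ g₂ j (σ₁≢σ₂ j))
            (regPerm-difference-off G F g₁ g₂) P? id

  rank₂ : RankAtLeast F M k₂
  rank₂ = twoEntryColumns⇒rankAtLeast F M σ₂ σ₁ (translate-injective G g₂)
            (λ j → regPerm-difference-pivotʳ G F g₁ g₂ j (σ₁≢σ₂ j))
            (λ r j r≢σ₂ r≢σ₁ → regPerm-difference-off G F g₁ g₂ r j r≢σ₁ r≢σ₂)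
            (¬? ∘ P?) (λ {j} σ₁≮σ₂ → Fin.≤∧≢⇒< (ℕ.≮⇒≥ σ₁≮σ₂) (σ₁≢σ₂ j ∘ ≡.sym))
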